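{- In every run of the algorithm $\mathcal{A}^{\mathrm{comb}}$ (against any comparator), at each round $i$ the size of $\mathcal{X}$ is reduced by at least a third: $n_{i+1}\le\frac23 n_i$, where $n_i$ denotes $|\mathcal{X}|$ at the start of round $i$.
   Context: Model: inputs are items with real values; a faulty comparator on two distinct inputs returns the larger if their values differ by more than $1$, and otherwise either one (possibly adversarially). Subroutine $\mathcal{A}^{\mathrm{qs\text{ - }sub}}$ (input multiset $\mathcal{X}$): pick a pivot $x_p\in\mathcal{X}$ uniformly at random, compare $x_p$ with all other inputs, let $\mathcal{Y}\subset\mathcal{X}\setminus\{x_p\}$ be those that beat $x_p$; output $\mathcal{Y}$ if nonempty and $\{x_p\}$ otherwise. Subroutine $\mathcal{A}^{\mathrm{ko\text{ - }sub}}$: pair the inputs uniformly at random, compare each pair (winners are recorded). Algorithm $\mathcal{A}^{\mathrm{comb}}$ (input $\mathcal{X},\epsilon$): set $\beta_1=9$, $\beta_2=25$, $i=0$. While $|\mathcal{X}|>1$: $i\leftarrow i+1$; $n_i=|\mathcal{X}|$; apply $\mathcal{X}\leftarrow\mathcal{A}^{\mathrm{qs\text{ - }sub}}(\mathcal{X})$ repeatedly $\lfloor\beta_1\log\frac1\epsilon\rfloor$ times; let $\mathcal{X}_i=\mathcal{X}$; if $|\mathcal{X}_i|>\frac23 n_i$, then run the random pairing of $\mathcal{A}^{\mathrm{ko\text{ - }sub}}$ on the fixed multiset $\mathcal{X}$ independently $T_i=\lfloor\beta_2(\frac43)^i\log\frac1\epsilon\rfloor$ times, counting each input's total wins; if some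 input has more than $\frac34T_i$ wins, let $\mathcal{X}$ be the multiset of inputs with more than $\frac34 T_i$ wins, otherwise let $\mathcal{X}$ consist of one input with the highest number of wins. When the loop ends, output $\mathcal{X}$. Here $\log$ is base 2. -}

module Defs where

open import Data.Nat using (ℕ; zero; suc; _+_; _*_; _≤_; _<_; _<ᵇ_)
open import Data.Bool using (Bool; true; false; not; if_then_else_; _∧_)
open import Data.Fin using (Fin; _≟_)
open import Data.List using (List; []; _∷_; length; map; null; allFin; lookup; filterᵇ)
open import Data.Product using (_×_; Σ; ∃; _,_)
open import Data.Sum using (_⊎_)
open import Relation.Binary.PropositionalEquality using (_≡_; _≢_)
open import Relation.Nullary using (does)

-- Gap x y  means  "value(x) > value(y) + 1",
-- i.e. the values of x and y differ by more than 1 and x is the larger.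
-- A comparison of x (first) with y (second) has outcome b : Bool,
-- b = true meaning x wins.  The outcome is forced when the gap exceeds 1,
-- and otherwise arbitrary (adversarial, possibly adaptive).
ValidOutcome : {A : Set} (Gap : A → A → Set) → A → A → Bool → Set
ValidOutcome Gap x y b = (Gap x y → b ≡ true) × (Gap y x → b ≡ false)

select : ∀ {n} → (Fin n → Bool) → List (Fin n)
select {n} f = filterᵇ f (allFin n)

subMulti : ∀ {A : Set} (xs : List A) → (Fin (length xs) → Bool) → List A
subMulti xs f = map (lookup xs) (select f)

-- A^{qs-sub}: pivot p, every other input j compared with the pivot;
-- beats j = true means j beats the pivot.

qsOutput : ∀ {A : Set} (xs : List A) → Fin (length xs) → (Fin (length xs) → Bool) → List A
qsOutput xs p beats with subMulti xs (λ j → not (does (j ≟ p)) ∧ beats j)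
... | [] = lookup xs p ∷ []
... | y ∷ ys = y ∷ ys

record QSStep {A : Set} (Gap : A → A → Set) (xs ys : List A) : Set where
  field
    pivot  : Fin (length xs)
    beats  : Fin (length xs) → Bool
    valid  : ∀ j → j ≢ pivot → ValidOutcome Gap (lookup xs j) (lookup xs pivot) (beats j)
    output : ys ≡ qsOutput xs pivot beats

data QSRep {A : Set} (Gap : A → A → Set) : ℕ → List A → List A → Set where
  done : ∀ {xs} → QSRep Gap zero xs xs
  step : ∀ {k xs ys zs} → QSStep Gap xs ys → QSRep Gap k ys zs → QSRep Gap (suc k) xs zs

-- A^{ko-sub}: a (maximal) random pairing of the n inputs, given as an
-- involution with at most one fixed point (the unpaired input when n is odd).

record Pairing (n : ℕ) : Set where
  field
    partner   : Fin n → Fin n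
    invol     : ∀ j → partner (partner j) ≡ j
    atMostOne : ∀ j k → partner j ≡ j → partner k ≡ k → j ≡ k

record KORun {A : Set} (Gap : A → A → Set) (xs : List A) : Set where
  field
    pairing   : Pairing (length xs)
    wins      : Fin (length xs) → Bool
    unpaired  : ∀ j → Pairing.partner pairing j ≡ j → wins j ≡ false
    oneWinner : ∀ j → Pairing.partner pairing j ≢ j →
                wins (Pairing.partner pairing j) ≡ not (wins j)
    valid     : ∀ j → Pairing.partner pairing j ≢ j →
                ValidOutcome Gap (lookup xs j) (lookup xs (Pairing.partner pairing j)) (wins j)

countTrue : ∀ T → (Fin T → Bool) → ℕ
countTrue zero    f = zero
countTrue (suc T) f = (if f Fin.zero then 1 else 0) + countTrue T (λ t → f (Fin.suc t))
  where import Data.Fin as Fin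

totalWins : ∀ {A : Set} {Gap : A → A → Set} {xs : List A} (T : ℕ) →
            (Fin T → KORun Gap xs) → Fin (length xs) → ℕ
totalWins T runs j = countTrue T (λ t → KORun.wins (runs t) j)

record KOStage {A : Set} (Gap : A → A → Set) (T : ℕ) (xs ys : List A) : Set where
  field
    runs   : Fin T → KORun Gap xs
  -- inputs with more than (3/4) T wins:  3 T < 4 w
  winners : Fin (length xs) → Bool
  winners j = (3 * T) <ᵇ (4 * totalWins T runs j)
  field
    output : (select winners ≢ [] × ys ≡ subMulti xs winners)
           ⊎ (select winners ≡ [] ×
              Σ (Fin (length xs)) (λ j →
                 (∀ k → totalWins T runs k ≤ totalWins T runs j) × ys ≡ lookup xs j ∷ []))

-- One round i of A^{comb}.  R stands for ⌊β₁ log(1/ε)⌋ and T i for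
-- T_i = ⌊β₂ (4/3)^i log(1/ε)⌋.

Round : {A : Set} (Gap : A → A → Set) (R : ℕ) (T : ℕ → ℕ) (i : ℕ) (xs ys : List A) → Set
Round Gap R T i xs ys =
  Σ _ λ xsᵢ → QSRep Gap R xs xsᵢ ×
    ((2 * length xs < 3 * length xsᵢ × KOStage Gap (T i) xsᵢ ys)
     ⊎ (3 * length xsᵢ ≤ 2 * length xs × ys ≡ xsᵢ))

-- Reach Gap R T X₀ i X : X is a possible value of 𝒳 at the start of round i
-- (i ≥ 1) of a run of A^{comb} on input X₀.
data Reach {A : Set} (Gap : A → A → Set) (R : ℕ) (T : ℕ → ℕ) (X₀ : List A) :
           ℕ → List A → Set where
  start : Reach Gap R T X₀ 1 X₀
  next  : ∀ {i X Y} → Reach Gap R T X₀ i X → 1 < length X →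
          Round Gap R T i X Y → Reach Gap R T X₀ (suc i) Y

module Submission where

-- A quicksort step outputs a sub-multiset of its input or the pivot alone, so it never
-- enlarges 𝒳; if these steps already shrink 𝒳 to 2/3 we are done.  Otherwise, in one
-- knockout run every input wins at most once and partners never both win, so there are
-- at most n/2 wins per run and at most T n/2 over T runs.  Each survivor has more than
-- 3T/4 of these wins, hence there are fewer than 2n/3 survivors; if there is none, a
-- single input survives, and 1 ≤ 2n/3 because n ≥ 2.

open import Defs
open import Data.Nat using (ℕ; _*_; _≤_; _<_)
open import Data.List using (List; length)

open import Data.Bool using (Bool; true; false; T?; not; if_then_else_; _∧_)
open import Data.Fin using (Fin; zero; suc; _≟_)
open import Data.Fin.Permutation using (permutation)
open import Data.Fin.Properties using (nonZeroIndex)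
open import Data.List using ([]; _∷_; filterᵇ; tabulate; allFin; lookup)
open import Data.List.Properties using (length-map; length-filter; length-tabulate)
open import Data.Nat using (zero; suc; _+_; z≤n; _<ᵇ_; >-nonZero⁻¹)
open import Data.Nat.Properties hiding (_≟_)
open import Data.Nat.Solver using (module +-*-Solver)
open import Data.Product using (_,_)
open import Data.Sum using (_⊎_; inj₁; inj₂)
open import Data.Unit using (tt)
open import Function using (_∘_; flip)
open import Relation.Binary.PropositionalEquality
open import Relation.Nullary using (does; yes; no)

open import Algebra.Properties.Semiring.Sum +-*-semiring
  using (sum; sum-cong-≗; ∑-comm; ∑-distrib-+; sum-permute; *-distribˡ-sum; *-distribʳ-sum)

open +-*-Solver using (solve; _:+_; _:*_; con; _:=_)

indicator : Bool → ℕ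
indicator b = if b then 1 else 0

count : ∀ {n} → (Fin n → Bool) → ℕ
count f = sum (indicator ∘ f)

sum-mono-≤ : ∀ {n} {f g : Fin n → ℕ} → (∀ j → f j ≤ g j) → sum f ≤ sum g
sum-mono-≤ {zero}  f≤g = z≤n
sum-mono-≤ {suc n} f≤g = +-mono-≤ (f≤g zero) (sum-mono-≤ (f≤g ∘ suc))

sum-const : ∀ n c → sum {n} (λ _ → c) ≡ n * c
sum-const zero    c = refl
sum-const (suc n) c = cong (c +_) (sum-const n c)

countTrue≡count : ∀ n (f : Fin n → Bool) → countTrue n f ≡ count f
countTrue≡count zero    f = refl
countTrue≡count (suc n) f = cong (indicator (f zero) +_) (countTrue≡count n (f ∘ suc))

length-filterᵇ-tabulate : ∀ {A : Set} {n} (p : A → Bool) (g : Fin n → A) →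
                          length (filterᵇ p (tabulate g)) ≡ count (p ∘ g)
length-filterᵇ-tabulate {n = zero}  p g = refl
length-filterᵇ-tabulate {n = suc n} p g with p (g zero)
... | true  = cong suc (length-filterᵇ-tabulate p (g ∘ suc))
... | false = length-filterᵇ-tabulate p (g ∘ suc)

length-subMulti : ∀ {A : Set} (xs : List A) f → length (subMulti xs f) ≡ count f
length-subMulti xs f =
  trans (length-map (lookup xs) (select f)) (length-filterᵇ-tabulate f (λ j → j))

length-subMulti-≤ : ∀ {A : Set} (xs : List A) f → length (subMulti xs f) ≤ length xs
length-subMulti-≤ xs f = begin
  length (subMulti xs f)       ≡⟨ length-map (lookup xs) (select f) ⟩
  length (select f)            ≤⟨ length-filter (T? ∘ f) (allFin (length xs)) ⟩
  length (allFin (length xs))  ≡⟨ length-tabulate {n = length xs} (λ j → j) ⟩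
  length xs                    ∎
  where open ≤-Reasoning

length-qsOutput-≤ : ∀ {A : Set} (xs : List A) p beats → length (qsOutput xs p beats) ≤ length xs
length-qsOutput-≤ xs p beats
  with subMulti xs (λ j → not (does (j ≟ p)) ∧ beats j)
     | length-subMulti-≤ xs (λ j → not (does (j ≟ p)) ∧ beats j)
... | []     | _ = >-nonZero⁻¹ (length xs) {{nonZeroIndex p}}
... | _ ∷ _  | ≤length = ≤length

QSStep-length-≤ : ∀ {A : Set} {Gap : A → A → Set} {xs ys} →
                  QSStep Gap xs ys → length ys ≤ length xs
QSStep-length-≤ {xs = xs} s rewrite QSStep.output s =
  length-qsOutput-≤ xs (QSStep.pivot s) (QSStep.beats s)

QSRep-length-≤ : ∀ {A : Set} {Gap : A → A → Set} {k xs ys} →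
                 QSRep Gap k xs ys → length ys ≤ length xs
QSRep-length-≤ done       = ≤-refl
QSRep-length-≤ (step s r) = ≤-trans (QSRep-length-≤ r) (QSStep-length-≤ s)

2*sum≤-involution : ∀ {n} (π : Fin n → Fin n) → (∀ j → π (π j) ≡ j) →
                    (w : Fin n → ℕ) → (∀ j → w j + w (π j) ≤ 1) → 2 * sum w ≤ n
2*sum≤-involution {n} π invol w pair≤1 = begin
  2 * sum w                 ≡⟨ cong (sum w +_) (+-identityʳ (sum w)) ⟩
  sum w + sum w             ≡⟨ cong (sum w +_) (sum-permute w (permutation π π invol invol)) ⟩
  sum w + sum (w ∘ π)       ≡⟨ ∑-distrib-+ w (w ∘ π) ⟨
  sum (λ j → w j + w (π j)) ≤⟨ sum-mono-≤ pair≤1 ⟩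
  sum {n} (λ _ → 1)         ≡⟨ sum-const n 1 ⟩
  n * 1                     ≡⟨ *-identityʳ n ⟩
  n                         ∎
  where open ≤-Reasoning

module _ {A : Set} {Gap : A → A → Set} {xs : List A} (r : KORun Gap xs) where
  open KORun r
  open Pairing pairing

  wins-partner-≤1 : ∀ j → indicator (wins j) + indicator (wins (partner j)) ≤ 1
  wins-partner-≤1 j with partner j ≟ j
  ... | yes fixed rewrite fixed | unpaired j fixed = z≤n
  ... | no moved  rewrite oneWinner j moved with wins j
  ...   | true  = ≤-refl
  ...   | false = ≤-refl

  2*count-wins≤length : 2 * count wins ≤ length xs
  2*count-wins≤length = 2*sum≤-involution partner invol (indicator ∘ wins) wins-partner-≤1

module _ {A : Set} {Gap : A → A → Set} {xs : List A} {T : ℕ}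
         (runs : Fin T → KORun Gap xs) where

  2*sum-totalWins≤ : 2 * sum (totalWins T runs) ≤ T * length xs
  2*sum-totalWins≤ = begin
    2 * sum (totalWins T runs)
      ≡⟨ cong (2 *_) (sum-cong-≗ (λ j → countTrue≡count T (flip win j))) ⟩
    2 * sum (λ j → count (flip win j))   ≡⟨ cong (2 *_) (∑-comm (λ j t → indicator (win t j))) ⟩
    2 * sum (λ t → count (win t))        ≡⟨ *-distribˡ-sum 2 (count ∘ win) ⟩
    sum (λ t → 2 * count (win t))        ≤⟨ sum-mono-≤ (2*count-wins≤length ∘ runs) ⟩
    sum {T} (λ _ → length xs)            ≡⟨ sum-const T (length xs) ⟩
    T * length xs                        ∎
    where
    open ≤-Reasoning
    win : Fin T → Fin (length xs) → Bool
    win = KORun.wins ∘ runs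

m*[1+3t]≤2*[t*n]⇒3*m≤2*n : ∀ t m n → m * suc (3 * t) ≤ 2 * (t * n) → 3 * m ≤ 2 * n
m*[1+3t]≤2*[t*n]⇒3*m≤2*n zero    m n m*1≤0
  rewrite n≤0⇒n≡0 (subst (_≤ 0) (*-identityʳ m) m*1≤0) = z≤n
m*[1+3t]≤2*[t*n]⇒3*m≤2*n (suc t) m n ≤2Tn = *-cancelˡ-≤ (suc t) (begin
  suc t * (3 * m)        ≤⟨ m≤m+n (suc t * (3 * m)) m ⟩
  suc t * (3 * m) + m    ≡⟨ solve 2 (λ t m → (con 1 :+ t) :* (con 3 :* m) :+ m
                                        := m :* (con 1 :+ con 3 :* (con 1 :+ t))) refl t m ⟩
  m * suc (3 * suc t)    ≤⟨ ≤2Tn ⟩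
  2 * (suc t * n)        ≡⟨ solve 2 (λ t n → con 2 :* ((con 1 :+ t) :* n)
                                        := (con 1 :+ t) :* (con 2 :* n)) refl t n ⟩
  suc t * (2 * n)        ∎)
  where open ≤-Reasoning

module _ {A : Set} {Gap : A → A → Set} {T : ℕ} {xs ys : List A}
         (ko : KOStage Gap T xs ys) where
  open KOStage ko

  winner-weight-≤ : ∀ j → indicator (winners j) * suc (3 * T) ≤ 4 * totalWins T runs j
  winner-weight-≤ j
    with (3 * T) <ᵇ (4 * totalWins T runs j) | <ᵇ⇒< (3 * T) (4 * totalWins T runs j)
  ... | true  | 3T<4w = ≤-trans (≤-reflexive (*-identityˡ (suc (3 * T)))) (3T<4w tt)
  ... | false | _     = z≤n

  count-winners-≤ : count winners * suc (3 * T) ≤ 2 * (T * length xs)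
  count-winners-≤ = begin
    count winners * suc (3 * T)
      ≡⟨ *-distribʳ-sum (suc (3 * T)) (indicator ∘ winners) ⟩
    sum (λ j → indicator (winners j) * suc (3 * T))  ≤⟨ sum-mono-≤ winner-weight-≤ ⟩
    sum (λ j → 4 * totalWins T runs j)               ≡⟨ *-distribˡ-sum 4 (totalWins T runs) ⟨
    4 * sum (totalWins T runs)                       ≡⟨ *-assoc 2 2 (sum (totalWins T runs)) ⟩
    2 * (2 * sum (totalWins T runs))                 ≤⟨ *-monoʳ-≤ 2 (2*sum-totalWins≤ {T = T} runs) ⟩
    2 * (T * length xs)                              ∎
    where open ≤-Reasoning

  KOStage-length : length ys ≡ 1 ⊎ 3 * length ys ≤ 2 * length xs
  KOStage-length with output
  ... | inj₂ (_ , _ , _ , ys≡[x]) = inj₁ (cong length ys≡[x])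
  ... | inj₁ (_ , ys≡winners) rewrite ys≡winners | length-subMulti xs winners =
          inj₂ (m*[1+3t]≤2*[t*n]⇒3*m≤2*n T (count winners) (length xs) count-winners-≤)

Round-length : ∀ {A : Set} {Gap : A → A → Set} {R : ℕ} {T : ℕ → ℕ} {i : ℕ} {X Y : List A} →
               1 < length X → Round Gap R T i X Y → 3 * length Y ≤ 2 * length X
Round-length _ (_ , _ , inj₂ (shrunk , refl)) = shrunk
Round-length 1<|X| (_ , qs , inj₁ (_ , ko)) with KOStage-length ko
... | inj₁ |Y|≡1 rewrite |Y|≡1 = ≤-trans (n≤1+n 3) (*-monoʳ-≤ 2 1<|X|)
... | inj₂ shrunk = ≤-trans shrunk (*-monoʳ-≤ 2 (QSRep-length-≤ qs))

-- The bound holds for every round from any multiset, reachable or not.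
lemma8 : {A : Set} (Gap : A → A → Set) (R : ℕ) (T : ℕ → ℕ) (X₀ : List A)
         (i : ℕ) (X Y : List A) →
         Reach Gap R T X₀ i X → 1 < length X → Round Gap R T i X Y →
         3 * length Y ≤ 2 * length X
lemma8 Gap R T _ i _ _ _ = Round-length {Gap = Gap} {R} {T} {i}
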